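{- Let ${\bf n}'=n'_1n'_2n'_3\cdots$ be the fixed point of $0\mapsto01$, $1\mapsto2$, $2\mapsto0$ starting with $0$, indexed from $1$ (so ${\bf n}'=0120010120120\cdots$). For $i\in\{0,1,2\}$ and $j\ge1$ let $p_i(j)$ be the position of the $j$-th occurrence of the letter $i$ in ${\bf n}'$, and let $p_{02}(j)$ be the position of the $j$-th occurrence of a letter from $\{0,2\}$ in ${\bf n}'$. Then for all $j\ge1$: $p_{02}(j)=[(j-1)_N0]_N+1$; $p_0(j)=[(j-1)_N00]_N+1$; $p_1(j)=[(j-1)_N000]_N+2=p_0(j)+j$; $p_2(j)=[(j-1)_N0000]_N+3=p_1(j)+p_{02}(j)$.
   Context: Narayana numbers: $N_0=1,N_1=2,N_2=3$, $N_i=N_{i-1}+N_{i-3}$ for $i\ge3$. Every nonnegative integer $m$ has a unique Narayana representation $(m)_N=e_1\cdots e_t$ (binary word, $e_1=1$ if $t\ge1$, no factor $11$ or $101$, $m=\sum_{i=1}^te_iN_{t-i}$; $(0)_N$ is empty). For a binary word $w=e_1\cdots e_t$, $[w]_N=\sum_{i=1}^t e_iN_{t-i}$. -}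

module Defs where

open import Data.Nat using (ℕ; zero; suc; _+_; _∸_; _≤_)
open import Data.Bool using (Bool; true; false; if_then_else_; T)
open import Data.List using (List; []; _∷_; _++_; length; concatMap; lookup)
open import Data.Maybe using (Maybe; just; nothing)
open import Data.Product using (Σ; ∃; _×_)
open import Data.Sum using (_⊎_)
open import Relation.Binary.PropositionalEquality using (_≡_; _≢_)

N : ℕ → ℕ
N 0 = 1
N 1 = 2
N 2 = 3
N (suc (suc (suc i))) = N (suc (suc i)) + N i

-- Binary words (true = 1, false = 0) and their Narayana value
-- [e₁⋯e_t]_N = Σ e_i N_{t-i}

bit : Bool → ℕ → ℕ
bit true  n = n
bit false n = 0

⟦_⟧N : List Bool → ℕ
⟦ [] ⟧N    = 0
⟦ e ∷ w ⟧N = bit e (N (length w)) + ⟦ w ⟧N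

-- w is the Narayana representation (m)_N of m:
-- empty or starts with 1, has no factor 11 and no factor 101, and [w]_N = m.
IsNarRep : ℕ → List Bool → Set
IsNarRep m w =
  (w ≡ [] ⊎ Σ (List Bool) (λ w′ → w ≡ true ∷ w′))
  × (∀ u v → w ≢ u ++ (true ∷ true ∷ v))
  × (∀ u v → w ≢ u ++ (true ∷ false ∷ true ∷ v))
  × ⟦ w ⟧N ≡ m

σ : ℕ → List ℕ
σ 0 = 0 ∷ 1 ∷ []
σ 1 = 2 ∷ []
σ _ = 0 ∷ []

σ^ : ℕ → List ℕ
σ^ zero    = 0 ∷ []
σ^ (suc k) = concatMap σ (σ^ k)

-- n′ k for k ≥ 1 (1-indexed): the k-th letter of σ^k(0), which has
-- length N k ≥ k, and is a prefix of the fixed point.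
-- (The value at k = 0 is irrelevant.)
lookupℕ : List ℕ → ℕ → Maybe ℕ
lookupℕ []       _       = nothing
lookupℕ (x ∷ xs) zero    = just x
lookupℕ (x ∷ xs) (suc i) = lookupℕ xs i

fromMaybe0 : Maybe ℕ → ℕ
fromMaybe0 (just x) = x
fromMaybe0 nothing  = 0

n′ : ℕ → ℕ
n′ k = fromMaybe0 (lookupℕ (σ^ k) (k ∸ 1))

is0 is1 is2 is02 : ℕ → Bool
is0 0 = true
is0 _ = false
is1 1 = true
is1 _ = false
is2 2 = true
is2 _ = false
is02 0 = true
is02 2 = true
is02 _ = false

count : (ℕ → Bool) → ℕ → ℕ
count S zero    = 0
count S (suc q) = (if S (n′ (suc q)) then 1 else 0) + count S q

IsPos : (ℕ → Bool) → ℕ → ℕ → Set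
IsPos S j q = 1 ≤ q × T (S (n′ q)) × count S q ≡ j

-- The word σ^k(0) has length N k and σ^(k+3)(0) = σ^(k+2)(0) σ^k(0).  Hence for a word u
-- without factors 11 and 101, the prefix of n′ of length [u]_N is the concatenation of the
-- blocks σ^(t-i)(0) over the digits e_i = 1 of u, and the next letter of n′ is read off the tail
-- of u: 1 after …1, 2 after …10, 0 otherwise.  If a letter class occurs N k times in σ^(k+d)(0),
-- the prefix for wz, |z| = d, contains [w]_N occurrences from the blocks of w.  Taking
-- z = 0, 00, 001, 0010 (d = 1, 2, 3, 4) therefore puts the ([w]_N+1)-th occurrence of
-- {0,2}, 0, 1, 2 at [wz]_N + 1; the two identities are the Narayana recurrence shifted by w.

module Submission where

open import Defs
open import Algebra.Properties.CommutativeSemigroup using (interchange)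
open import Data.Bool using (Bool; true; false; if_then_else_; T)
open import Data.Empty using (⊥-elim)
open import Data.List using (List; []; _∷_; _++_; length; concat; map; concatMap; replicate)
open import Data.Maybe using (just)
open import Data.List.Properties using (length-++; ++-assoc; ++-identityʳ; map-++; concat-++; length-replicate)
open import Data.Nat using (ℕ; zero; suc; _+_; _∸_; _≤_; _<_; _≤′_; ≤′-refl; ≤′-step; z≤n; s≤s)
open import Data.Nat.Properties using (+-comm; +-assoc; +-suc; +-identityʳ; ≤-total; ≤-trans; <⇒≤; ≤⇒≤′; m<m+n; +-commutativeSemigroup; module ≤-Reasoning)
open import Data.Nat.Tactic.RingSolver using (solve-∀)
open import Data.Product using (_×_; _,_; ∃; proj₁)
open import Data.Sum using (inj₁; inj₂)
open import Data.Unit using (tt)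
open import Function using (_∘_)
open import Relation.Binary.PropositionalEquality

concatMap-++ : ∀ {A B : Set} (f : A → List B) xs ys →
  concatMap f (xs ++ ys) ≡ concatMap f xs ++ concatMap f ys
concatMap-++ f xs ys = trans (cong concat (map-++ f xs ys)) (sym (concat-++ (map f xs) (map f ys)))

σ^-rec : ∀ k → σ^ (3 + k) ≡ σ^ (2 + k) ++ σ^ k
σ^-rec zero    = refl
σ^-rec (suc k) = trans (cong (concatMap σ) (σ^-rec k)) (concatMap-++ σ (σ^ (2 + k)) (σ^ k))

length-σ^ : ∀ k → length (σ^ k) ≡ N k
length-σ^ 0 = refl
length-σ^ 1 = refl
length-σ^ 2 = refl
length-σ^ (suc (suc (suc k))) = begin
  length (σ^ (3 + k))               ≡⟨ cong length (σ^-rec k) ⟩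
  length (σ^ (2 + k) ++ σ^ k)       ≡⟨ length-++ (σ^ (2 + k)) ⟩
  length (σ^ (2 + k)) + length (σ^ k) ≡⟨ cong₂ _+_ (length-σ^ (suc (suc k))) (length-σ^ k) ⟩
  N (2 + k) + N k                   ∎
  where open ≡-Reasoning

σ^-prefix-suc : ∀ k → ∃ λ r → σ^ k ++ r ≡ σ^ (suc k)
σ^-prefix-suc 0 = 1 ∷ [] , refl
σ^-prefix-suc 1 = 2 ∷ [] , refl
σ^-prefix-suc (suc (suc k)) = σ^ k , sym (σ^-rec k)

σ^-prefix : ∀ {k m} → k ≤′ m → ∃ λ r → σ^ k ++ r ≡ σ^ m
σ^-prefix {k} ≤′-refl = [] , ++-identityʳ (σ^ k)
σ^-prefix {k} (≤′-step {m} k≤m) with σ^-prefix k≤m | σ^-prefix-suc m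
... | r , eq | r′ , eq′ = r ++ r′ , trans (sym (++-assoc (σ^ k) r r′)) (trans (cong (_++ r′) eq) eq′)

n<N : ∀ n → n < N n
n<N 0 = s≤s z≤n
n<N 1 = s≤s (s≤s z≤n)
n<N 2 = s≤s (s≤s (s≤s z≤n))
n<N (suc (suc (suc k))) = begin-strict
  3 + k           ≤⟨ n<N (suc (suc k)) ⟩
  N (2 + k)       <⟨ m<m+n (N (2 + k)) (≤-trans (s≤s z≤n) (n<N k)) ⟩
  N (2 + k) + N k ∎
  where open ≤-Reasoning

lookupℕ-++ˡ : ∀ (xs ys : List ℕ) {i} → i < length xs → lookupℕ (xs ++ ys) i ≡ lookupℕ xs i
lookupℕ-++ˡ (x ∷ xs) ys {zero}  _         = refl
lookupℕ-++ˡ (x ∷ xs) ys {suc i} (s≤s i<n) = lookupℕ-++ˡ xs ys i<n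

lookupℕ-++-length : ∀ (xs : List ℕ) x ys → lookupℕ (xs ++ x ∷ ys) (length xs) ≡ just x
lookupℕ-++-length []       x ys = refl
lookupℕ-++-length (_ ∷ xs) x ys = lookupℕ-++-length xs x ys

lookup-σ^-stable : ∀ {i k m} → i < N k → k ≤ m → lookupℕ (σ^ m) i ≡ lookupℕ (σ^ k) i
lookup-σ^-stable {i} {k} i<Nk k≤m with σ^-prefix (≤⇒≤′ k≤m)
... | r , eq = trans (cong (λ xs → lookupℕ xs i) (sym eq))
                     (lookupℕ-++ˡ (σ^ k) r (subst (i <_) (sym (length-σ^ k)) i<Nk))

n′-lookup : ∀ {i m} → i < N m → n′ (suc i) ≡ fromMaybe0 (lookupℕ (σ^ m) i)
n′-lookup {i} {m} i<Nm with ≤-total (suc i) m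
... | inj₁ le = cong fromMaybe0 (sym (lookup-σ^-stable (<⇒≤ (n<N (suc i))) le))
... | inj₂ le = cong fromMaybe0 (lookup-σ^-stable i<Nm le)

n′-at : ∀ {m} (a : List ℕ) x r → a ++ x ∷ r ≡ σ^ m → n′ (suc (length a)) ≡ x
n′-at {m} a x r eq = trans (n′-lookup {m = m} a<N) (cong fromMaybe0 (trans
  (cong (λ xs → lookupℕ xs (length a)) (sym eq)) (lookupℕ-++-length a x r)))
  where
  a<N : length a < N m
  a<N = subst (length a <_) (trans (sym (length-++ a)) (trans (cong length eq) (length-σ^ m)))
              (m<m+n (length a) (s≤s z≤n))

countList : (ℕ → Bool) → List ℕ → ℕ
countList S []       = 0
countList S (x ∷ xs) = (if S x then 1 else 0) + countList S xs

countList-++ : ∀ S xs ys → countList S (xs ++ ys) ≡ countList S xs + countList S ys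
countList-++ S []       ys = refl
countList-++ S (x ∷ xs) ys =
  trans (cong ((if S x then 1 else 0) +_) (countList-++ S xs ys)) (sym (+-assoc (if S x then 1 else 0) _ _))

count-++ : ∀ S {m} a xs r → a ++ xs ++ r ≡ σ^ m →
  count S (length a + length xs) ≡ count S (length a) + countList S xs
count-++ S a []       r eq = trans (cong (count S) (+-identityʳ (length a))) (sym (+-identityʳ _))
count-++ S {m} a (x ∷ xs) r eq = begin
  count S (length a + suc (length xs))
    ≡⟨ cong (count S) (trans (+-suc (length a) (length xs)) (cong (_+ length xs) (sym ∣a∷ʳx∣))) ⟩
  count S (length (a ++ x ∷ []) + length xs)
    ≡⟨ count-++ S {m} (a ++ x ∷ []) xs r (trans (++-assoc a (x ∷ []) (xs ++ r)) eq) ⟩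
  count S (length (a ++ x ∷ [])) + countList S xs
    ≡⟨ cong (λ n → count S n + countList S xs) ∣a∷ʳx∣ ⟩
  ((if S (n′ (suc (length a))) then 1 else 0) + count S (length a)) + countList S xs
    ≡⟨ cong (λ y → ((if S y then 1 else 0) + count S (length a)) + countList S xs) (n′-at {m} a x (xs ++ r) eq) ⟩
  ((if S x then 1 else 0) + count S (length a)) + countList S xs
    ≡⟨ trans (cong (_+ countList S xs) (+-comm (if S x then 1 else 0) _)) (+-assoc (count S (length a)) _ _) ⟩
  count S (length a) + countList S (x ∷ xs) ∎
  where
  open ≡-Reasoning
  ∣a∷ʳx∣ : length (a ++ x ∷ []) ≡ suc (length a)
  ∣a∷ʳx∣ = trans (length-++ a) (+-comm (length a) 1)

N-unique : (f : ℕ → ℕ) → f 0 ≡ 1 → f 1 ≡ 2 → f 2 ≡ 3 →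
  (∀ k → f (3 + k) ≡ f (2 + k) + f k) → ∀ k → f k ≡ N k
N-unique f f0 f1 f2 rec k = proj₁ (go k)
  where
  go : ∀ k → f k ≡ N k × f (1 + k) ≡ N (1 + k) × f (2 + k) ≡ N (2 + k)
  go zero    = f0 , f1 , f2
  go (suc k) with go k
  ... | e₀ , e₁ , e₂ = e₁ , e₂ , trans (rec k) (cong₂ _+_ e₂ e₀)

countList-σ^ : ∀ S d → countList S (σ^ d) ≡ 1 → countList S (σ^ (1 + d)) ≡ 2 → countList S (σ^ (2 + d)) ≡ 3 →
  ∀ k → countList S (σ^ (k + d)) ≡ N k
countList-σ^ S d c₀ c₁ c₂ = N-unique (λ k → countList S (σ^ (k + d))) c₀ c₁ c₂
  (λ k → trans (cong (countList S) (σ^-rec (k + d))) (countList-++ S (σ^ (2 + k + d)) (σ^ (k + d))))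

-- Words without factors 11 and 101 (leading zeros allowed), indexed by the letter of n′ that
-- follows its prefix of length [ u ]_N.
data Admissible : List Bool → ℕ → Set where
  ε     : Admissible [] 0
  0∷_   : ∀ {w c} → Admissible w c → Admissible (false ∷ w) c
  1∷ε   : Admissible (true ∷ []) 1
  10∷ε  : Admissible (true ∷ false ∷ []) 2
  100∷_ : ∀ {w c} → Admissible w c → Admissible (true ∷ false ∷ false ∷ w) c

Avoids : List Bool → List Bool → Set
Avoids f w = ∀ u v → w ≢ u ++ f ++ v

Avoids-++⁻ʳ : ∀ {f} p {w} → Avoids f (p ++ w) → Avoids f w
Avoids-++⁻ʳ {f} p avoids u v eq = avoids (p ++ u) v (trans (cong (p ++_) eq) (sym (++-assoc p u (f ++ v))))

admissible : ∀ w → Avoids (true ∷ true ∷ []) w → Avoids (true ∷ false ∷ true ∷ []) w → ∃ (Admissible w)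
admissible [] _ _ = 0 , ε
admissible (false ∷ w) no11 no101 with admissible w (Avoids-++⁻ʳ (false ∷ []) no11) (Avoids-++⁻ʳ (false ∷ []) no101)
... | c , adm = c , 0∷ adm
admissible (true ∷ []) _ _ = 1 , 1∷ε
admissible (true ∷ true ∷ v) no11 _ = ⊥-elim (no11 [] v refl)
admissible (true ∷ false ∷ []) _ _ = 2 , 10∷ε
admissible (true ∷ false ∷ true ∷ v) _ no101 = ⊥-elim (no101 [] v refl)
admissible (true ∷ false ∷ false ∷ w) no11 no101
  with admissible w (Avoids-++⁻ʳ (true ∷ false ∷ false ∷ []) no11) (Avoids-++⁻ʳ (true ∷ false ∷ false ∷ []) no101)
... | c , adm = c , 100∷ adm

admissible-∷ʳ0 : ∀ {w c} → Admissible w c → ∃ λ c′ → T (is02 c′) × Admissible (w ++ false ∷ []) c′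
admissible-∷ʳ0 ε = 0 , tt , 0∷ ε
admissible-∷ʳ0 (0∷ adm) with admissible-∷ʳ0 adm
... | c′ , s , adm′ = c′ , s , 0∷ adm′
admissible-∷ʳ0 1∷ε = 2 , tt , 10∷ε
admissible-∷ʳ0 10∷ε = 0 , tt , 100∷ ε
admissible-∷ʳ0 (100∷ adm) with admissible-∷ʳ0 adm
... | c′ , s , adm′ = c′ , s , 100∷ adm′

admissible-++00 : ∀ {v w c d} → Admissible v c → Admissible w d → Admissible (w ++ false ∷ false ∷ v) c
admissible-++00 adm ε          = 0∷ 0∷ adm
admissible-++00 adm (0∷ adm′)  = 0∷ admissible-++00 adm adm′
admissible-++00 adm 1∷ε        = 100∷ adm
admissible-++00 adm 10∷ε       = 100∷ 0∷ adm
admissible-++00 adm (100∷ adm′) = 100∷ admissible-++00 adm adm′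

narPrefix : List Bool → List ℕ
narPrefix []          = []
narPrefix (false ∷ w) = narPrefix w
narPrefix (true ∷ w)  = σ^ (length w) ++ narPrefix w

length-narPrefix : ∀ u → length (narPrefix u) ≡ ⟦ u ⟧N
length-narPrefix []          = refl
length-narPrefix (false ∷ w) = length-narPrefix w
length-narPrefix (true ∷ w)  =
  trans (length-++ (σ^ (length w))) (cong₂ _+_ (length-σ^ (length w)) (length-narPrefix w))

narPrefix-next : ∀ {u c} → Admissible u c → ∃ λ r → narPrefix u ++ c ∷ r ≡ σ^ (length u)
narPrefix-next ε = [] , refl
narPrefix-next (0∷_ {w} {c} adm) with narPrefix-next adm | σ^-prefix-suc (length w)
... | r , eq | r′ , eq′ =
  r ++ r′ , trans (sym (++-assoc (narPrefix w) (c ∷ r) r′)) (trans (cong (_++ r′) eq) eq′)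
narPrefix-next 1∷ε = [] , refl
narPrefix-next 10∷ε = [] , refl
narPrefix-next (100∷_ {w} adm) with narPrefix-next adm
... | r , eq = r , trans (++-assoc (σ^ (2 + length w)) (narPrefix w) _)
                         (trans (cong (σ^ (2 + length w) ++_) eq) (sym (σ^-rec (length w))))

countList-narPrefix-++ : ∀ S z → (∀ k → countList S (σ^ (k + length z)) ≡ N k) →
  ∀ w → countList S (narPrefix (w ++ z)) ≡ ⟦ w ⟧N + countList S (narPrefix z)
countList-narPrefix-++ S z countσ^ []          = refl
countList-narPrefix-++ S z countσ^ (false ∷ w) = countList-narPrefix-++ S z countσ^ w
countList-narPrefix-++ S z countσ^ (true ∷ w)  = begin
  countList S (σ^ (length (w ++ z)) ++ narPrefix (w ++ z))
    ≡⟨ countList-++ S (σ^ (length (w ++ z))) (narPrefix (w ++ z)) ⟩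
  countList S (σ^ (length (w ++ z))) + countList S (narPrefix (w ++ z))
    ≡⟨ cong₂ _+_ (trans (cong (countList S ∘ σ^) (length-++ w)) (countσ^ (length w)))
                 (countList-narPrefix-++ S z countσ^ w) ⟩
  N (length w) + (⟦ w ⟧N + countList S (narPrefix z))
    ≡⟨ sym (+-assoc (N (length w)) ⟦ w ⟧N _) ⟩
  N (length w) + ⟦ w ⟧N + countList S (narPrefix z) ∎
  where open ≡-Reasoning

if-T : ∀ {b} → T b → (if b then 1 else 0) ≡ 1
if-T {true} _ = refl

position-of-next : ∀ S {u c} → Admissible u c → T (S c) →
  IsPos S (suc (countList S (narPrefix u))) (suc ⟦ u ⟧N)
position-of-next S {u} {c} adm s with narPrefix-next adm
... | r , eq = s≤s z≤n , subst (T ∘ S) (sym letter) s , counted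
  where
  open ≡-Reasoning
  letter : n′ (suc ⟦ u ⟧N) ≡ c
  letter = subst (λ n → n′ (suc n) ≡ c) (length-narPrefix u) (n′-at {length u} (narPrefix u) c r eq)
  counted : count S (suc ⟦ u ⟧N) ≡ suc (countList S (narPrefix u))
  counted = begin
    (if S (n′ (suc ⟦ u ⟧N)) then 1 else 0) + count S ⟦ u ⟧N
      ≡⟨ cong (λ x → (if S x then 1 else 0) + count S ⟦ u ⟧N) letter ⟩
    (if S c then 1 else 0) + count S ⟦ u ⟧N
      ≡⟨ cong₂ _+_ (if-T s) (subst (λ n → count S n ≡ countList S (narPrefix u)) (length-narPrefix u)
                                   (count-++ S {length u} [] (narPrefix u) (c ∷ r) eq)) ⟩
    suc (countList S (narPrefix u)) ∎

replicate-false : ∀ n → ⟦ replicate n false ⟧N ≡ 0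
replicate-false zero    = refl
replicate-false (suc n) = replicate-false n

⟦⟧-++ : ∀ w z → ⟦ w ++ z ⟧N ≡ ⟦ w ++ replicate (length z) false ⟧N + ⟦ z ⟧N
⟦⟧-++ []      z = sym (cong (_+ ⟦ z ⟧N) (replicate-false (length z)))
⟦⟧-++ (e ∷ w) z = begin
  bit e (N (length (w ++ z))) + ⟦ w ++ z ⟧N
    ≡⟨ cong₂ _+_ (cong (bit e ∘ N) same-length) (⟦⟧-++ w z) ⟩
  bit e (N (length (w ++ zeros))) + (⟦ w ++ zeros ⟧N + ⟦ z ⟧N)
    ≡⟨ sym (+-assoc (bit e (N (length (w ++ zeros)))) _ _) ⟩
  bit e (N (length (w ++ zeros))) + ⟦ w ++ zeros ⟧N + ⟦ z ⟧N ∎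
  where
  open ≡-Reasoning
  zeros = replicate (length z) false
  same-length : length (w ++ z) ≡ length (w ++ zeros)
  same-length = trans (length-++ w) (trans (cong (length w +_) (sym (length-replicate (length z))))
                                           (sym (length-++ w)))

occurrence : ∀ S z → (∀ k → countList S (σ^ (k + length z)) ≡ N k) → countList S (narPrefix z) ≡ 0 →
  ∀ w {c} → T (S c) → Admissible (w ++ z) c →
  IsPos S (suc ⟦ w ⟧N) (⟦ w ++ replicate (length z) false ⟧N + suc ⟦ z ⟧N)
occurrence S z countσ^ count-z w s adm =
  subst₂ (IsPos S) (cong suc counted) position (position-of-next S adm s)
  where
  counted : countList S (narPrefix (w ++ z)) ≡ ⟦ w ⟧N
  counted = trans (countList-narPrefix-++ S z countσ^ w) (trans (cong (⟦ w ⟧N +_) count-z) (+-identityʳ _))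
  position : suc ⟦ w ++ z ⟧N ≡ ⟦ w ++ replicate (length z) false ⟧N + suc ⟦ z ⟧N
  position = trans (cong suc (⟦⟧-++ w z)) (sym (+-suc _ _))

bit-+ : ∀ e x y → bit e (x + y) ≡ bit e x + bit e y
bit-+ true  x y = refl
bit-+ false x y = refl

⟦⟧-++000 : ∀ w → ⟦ w ++ false ∷ false ∷ false ∷ [] ⟧N ≡ ⟦ w ++ false ∷ false ∷ [] ⟧N + ⟦ w ⟧N
⟦⟧-++000 []      = refl
⟦⟧-++000 (e ∷ w) = begin
  bit e (N (length (w ++ false ∷ false ∷ false ∷ []))) + ⟦ w ++ false ∷ false ∷ false ∷ [] ⟧N
    ≡⟨ cong₂ _+_ (trans (cong (bit e) N-length) (bit-+ e _ _)) (⟦⟧-++000 w) ⟩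
  (bit e (N (length (w ++ false ∷ false ∷ []))) + bit e (N (length w)))
    + (⟦ w ++ false ∷ false ∷ [] ⟧N + ⟦ w ⟧N)
    ≡⟨ interchange +-commutativeSemigroup (bit e (N (length (w ++ false ∷ false ∷ [])))) (bit e (N (length w)))
                    ⟦ w ++ false ∷ false ∷ [] ⟧N ⟦ w ⟧N ⟩
  (bit e (N (length (w ++ false ∷ false ∷ []))) + ⟦ w ++ false ∷ false ∷ [] ⟧N)
    + (bit e (N (length w)) + ⟦ w ⟧N) ∎
  where
  open ≡-Reasoning
  N-length : N (length (w ++ false ∷ false ∷ false ∷ [])) ≡ N (length (w ++ false ∷ false ∷ [])) + N (length w)
  N-length rewrite length-++ w {false ∷ false ∷ false ∷ []} | length-++ w {false ∷ false ∷ []}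
                 | +-comm (length w) 3 | +-comm (length w) 2 = refl

⟦⟧-++0000 : ∀ w → ⟦ w ++ false ∷ false ∷ false ∷ false ∷ [] ⟧N
                 ≡ ⟦ w ++ false ∷ false ∷ false ∷ [] ⟧N + ⟦ w ++ false ∷ [] ⟧N
⟦⟧-++0000 w = begin
  ⟦ w ++ false ∷ false ∷ false ∷ false ∷ [] ⟧N
    ≡⟨ cong ⟦_⟧N (sym (++-assoc w (false ∷ []) (false ∷ false ∷ false ∷ []))) ⟩
  ⟦ (w ++ false ∷ []) ++ false ∷ false ∷ false ∷ [] ⟧N
    ≡⟨ ⟦⟧-++000 (w ++ false ∷ []) ⟩
  ⟦ (w ++ false ∷ []) ++ false ∷ false ∷ [] ⟧N + ⟦ w ++ false ∷ [] ⟧N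
    ≡⟨ cong (λ v → ⟦ v ⟧N + ⟦ w ++ false ∷ [] ⟧N) (++-assoc w (false ∷ []) (false ∷ false ∷ [])) ⟩
  ⟦ w ++ false ∷ false ∷ false ∷ [] ⟧N + ⟦ w ++ false ∷ [] ⟧N ∎
  where open ≡-Reasoning

theorem19 : (j : ℕ) → 1 ≤ j → (w : List Bool) → IsNarRep (j ∸ 1) w →
    IsPos is02 j (⟦ w ++ false ∷ [] ⟧N + 1)
    × IsPos is0 j (⟦ w ++ false ∷ false ∷ [] ⟧N + 1)
    × IsPos is1 j (⟦ w ++ false ∷ false ∷ false ∷ [] ⟧N + 2)
    × ⟦ w ++ false ∷ false ∷ false ∷ [] ⟧N + 2 ≡ (⟦ w ++ false ∷ false ∷ [] ⟧N + 1) + j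
    × IsPos is2 j (⟦ w ++ false ∷ false ∷ false ∷ false ∷ [] ⟧N + 3)
    × ⟦ w ++ false ∷ false ∷ false ∷ false ∷ [] ⟧N + 3
        ≡ (⟦ w ++ false ∷ false ∷ false ∷ [] ⟧N + 2) + (⟦ w ++ false ∷ [] ⟧N + 1)
theorem19 (suc _) (s≤s z≤n) w (_ , no11 , no101 , refl) with admissible w no11 no101
... | _ , adm with admissible-∷ʳ0 adm
... | _ , s , adm0 =
    occurrence is02 (false ∷ []) (countList-σ^ is02 1 refl refl refl) refl w s adm0
  , occurrence is0 (false ∷ false ∷ []) (countList-σ^ is0 2 refl refl refl) refl w tt
      (admissible-++00 ε adm)
  , occurrence is1 (false ∷ false ∷ true ∷ []) (countList-σ^ is1 3 refl refl refl) refl w tt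
      (admissible-++00 1∷ε adm)
  , trans (cong (_+ 2) (⟦⟧-++000 w)) (shift₁ ⟦ w ++ false ∷ false ∷ [] ⟧N ⟦ w ⟧N)
  , occurrence is2 (false ∷ false ∷ true ∷ false ∷ []) (countList-σ^ is2 4 refl refl refl) refl w tt
      (admissible-++00 10∷ε adm)
  , trans (cong (_+ 3) (⟦⟧-++0000 w)) (shift₂ ⟦ w ++ false ∷ false ∷ false ∷ [] ⟧N ⟦ w ++ false ∷ [] ⟧N)
  where
  shift₁ : ∀ y z → (y + z) + 2 ≡ (y + 1) + suc z
  shift₁ = solve-∀
  shift₂ : ∀ y z → (y + z) + 3 ≡ (y + 2) + (z + 1)
  shift₂ = solve-∀
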